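{- Let $n\ge5$. Then the Wasserstein fan $\mathcal{GP}_n$ is neither a refinement nor a coarsening of the subdivision of the metric cone $\mathcal M_n$ induced by the secondary fan of the second hypersimplex $\Delta_{2,n}$. That is: (a) there exist $n$-metrics $\rho,\rho'$ lying in the same relatively open cell of $\mathcal{GP}_n$ such that the regular subdivisions $\Delta_{2,n}(\rho)$ and $\Delta_{2,n}(\rho')$ differ; and (b) there exist $n$-metrics $\rho,\rho'$ with $\Delta_{2,n}(\rho)=\Delta_{2,n}(\rho')$ lying in different relatively open cells of $\mathcal{GP}_n$.
   Context: An $n$-metric is a real symmetric $n\times n$ matrix with zero diagonal, positive off-diagonal entries, and satisfying the triangle inequality; it is identified with the point $(\rho_{ij})_{i<j}$ of $\mathbb{R}^{\binom n2}$, and the set of these points is the metric cone $\mathcal M_n$. For $k\ge2$ and $k$-tuples $\mathbf a,\mathbf b$ of elements of $[n]$ with all $2k$ entries pairwise distinct, $H_{\mathbf a,\mathbf b}=\{x:\sum_{i=1}^k x_{\{a_i,b_i\}}=\sum_{i=1}^k x_{\{a_i,b_{i+1}\}}\}$, $b_{k+1}=b_1$; the Wasserstein fan $\mathcal{GP}_n$ has as cells the intersections of the relatively open faces of the arrangement of all these hyperplanes with $\mathcal M_n$. The second hypersimplex is $\Delta_{2,n}=\mathrm{conv}\{e_i+e_j:i\ne j\}\subset\mathbb{R}^n$; $\Delta_{2,n}(\rho)$ is the regular subdivision of the point set $\{e_i+e_j: i<j\}$ obtained with heights $\rho_{ij}$, i.e., the projection of the lower faces of $\mathrm{conv}\{(e_i+e_j,\rho_{ij})\}\subset\mathbb{R}^{n+1}$.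 The secondary fan of $\Delta_{2,n}$ induces the subdivision of $\mathcal M_n$ into classes of metrics inducing the same subdivision $\Delta_{2,n}(\rho)$ (equivalently, the same combinatorial type of tight span). -}

module Defs where

open import Data.Nat using (ℕ; suc)
open import Data.Fin using (Fin)
open import Data.Rational using (ℚ; 0ℚ; _+_; _≤_; _<_)
open import Data.Vec using (Vec; []; _∷_; _∷ʳ_; zipWith; toList)
open import Data.List using (_++_)
open import Data.List.Relation.Unary.Unique.Propositional using (Unique)
open import Data.Product using (Σ; _×_; ∃)
open import Data.Bool using (Bool; true)
open import Relation.Binary.PropositionalEquality using (_≡_; _≢_)
open import Function.Bundles using (_⇔_)

Dist : ℕ → Set
Dist n = Fin n → Fin n → ℚ

record IsMetric (n : ℕ) (ρ : Dist n) : Set where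
  field
    symm : ∀ i j → ρ i j ≡ ρ j i
    diag : ∀ i → ρ i i ≡ 0ℚ
    pos  : ∀ i j → i ≢ j → 0ℚ < ρ i j
    tri  : ∀ i j k → ρ i k ≤ ρ i j + ρ j k

sumℚ : ∀ {k} → Vec ℚ k → ℚ
sumℚ []       = 0ℚ
sumℚ (x ∷ xs) = x + sumℚ xs

rotate : ∀ {A : Set} {k} → Vec A (suc k) → Vec A (suc k)
rotate (x ∷ xs) = xs ∷ʳ x

-- Data of a hyperplane H_{a,b}: k = m+2 ≥ 2, all 2k entries pairwise distinct.
record HypData (n : ℕ) : Set where
  constructor hyp
  field
    m    : ℕ
    a b  : Vec (Fin n) (suc (suc m))
    dist : Unique (toList a ++ toList b)

lhsH : ∀ {n} → Dist n → HypData n → ℚ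
lhsH ρ (hyp m a b _) = sumℚ (zipWith ρ a b)

rhsH : ∀ {n} → Dist n → HypData n → ℚ
rhsH ρ (hyp m a b _) = sumℚ (zipWith ρ a (rotate b))

-- ρ and ρ' lie in the same relatively open face of the arrangement of all
-- hyperplanes H_{a,b}: they lie on the same side of (or on) every hyperplane.
-- For metrics this is "same relatively open cell of the Wasserstein fan GP_n".
SameCell : ∀ {n} → Dist n → Dist n → Set
SameCell {n} ρ ρ' = ∀ (h : HypData n) →
  ((lhsH ρ h < rhsH ρ h) ⇔ (lhsH ρ' h < rhsH ρ' h)) ×
  ((lhsH ρ h ≡ rhsH ρ h) ⇔ (lhsH ρ' h ≡ rhsH ρ' h)) ×
  ((rhsH ρ h < lhsH ρ h) ⇔ (rhsH ρ' h < lhsH ρ' h))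

-- A set S of points e_i+e_j (i<j), given by a Boolean predicate on pairs
-- (only values at i<j matter), is the point set of a lower face of
-- conv{(e_i+e_j, ρ_ij)}: there is an affine function x ↦ w·x + c lying weakly
-- below all lifted points, with equality exactly at the points of S.
IsLowerFace : ∀ {n} → Dist n → (Fin n → Fin n → Bool) → Set
IsLowerFace {n} ρ S =
  Σ (Fin n → ℚ) λ w → Σ ℚ λ c → ∀ (i j : Fin n) → i Data.Fin.< j →
    (w i + w j + c ≤ ρ i j) × ((S i j ≡ true) ⇔ (ρ i j ≡ w i + w j + c))

-- The regular subdivisions Δ_{2,n}(ρ) and Δ_{2,n}(ρ') coincide:
-- they have exactly the same (lower) faces.
SameSubdivision : ∀ {n} → Dist n → Dist n → Set
SameSubdivision {n} ρ ρ' = ∀ (S : Fin n → Fin n → Bool) → IsLowerFace ρ S ⇔ IsLowerFace ρ' S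

{-# OPTIONS --safe #-}
module Submission where

open import Defs
open import Data.Nat using (ℕ; _≤_)
open import Data.Product using (Σ; _×_)
open import Relation.Nullary using (¬_)

-- Both examples perturb the uniform metric 10 on the edges of the triangle 0 1 2.  A side of a
-- hyperplane H_{a,b} is a matching, and a matching contains at most one edge of a triangle, so the
-- cell of such a metric only depends on how the three edge weights and 0 are ordered.  The regular
-- subdivision also sees balanced relations with two triangle edges on one side, such as
-- 02 + 12 + 34 = 01 + 23 + 24; this gives (a).  For (b), ρ₂ = ½ (ρ₁ + 3·[01]) + 5 and
-- ρ₁ = ½ (ρ₂ + 3·[02]) + 5.  Raising the point 01 of ρ₁ changes no lower face, because by the
-- exchange inequality no lower face contains 01 together with a pair disjoint from it; yet the
-- hyperplane 01 + 23 = 02 + 13 separates ρ₁ from ρ₂.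

open import Agda.Builtin.FromNat using (Number; fromNat)
open import Agda.Builtin.FromNeg using (Negative; fromNeg)
import Data.Nat as ℕ
import Data.Nat.Literals as ℕLiterals
open import Data.Nat using (zero; suc; s≤s; z≤n; z<s; s<s)
open import Data.Fin using (Fin; zero; suc)
import Data.Fin as Fin
import Data.Fin.Literals as FinLiterals
open import Data.Fin.Properties using (all?; <-cmp; <⇒≢)
open import Data.Rational using (ℚ; 0ℚ; 1ℚ; ½; _+_; _*_; _-_; -_)
import Data.Rational as ℚ
import Data.Rational.Literals as ℚLiterals
import Data.Rational.Properties as ℚₚ
open import Data.Rational.Solver using (module +-*-Solver)
open import Data.Bool using (Bool; true; false; if_then_else_)
open import Data.Unit using (tt)
open import Data.Empty using (⊥-elim)
open import Data.Sum using (_⊎_; inj₁; inj₂)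
open import Data.Product using (_,_; proj₁; proj₂; uncurry)
open import Data.Vec using (Vec; []; _∷_; toList; zipWith; replicate; lookup)
open import Data.Vec.Properties using (toList-∷ʳ)
open import Data.List using (List; _++_)
import Data.List as List
open import Data.List.Relation.Unary.All using (All; _∷_; [])
open import Data.List.Relation.Unary.AllPairs using (_∷_; [])
open import Data.List.Relation.Unary.Unique.Propositional using (Unique)
import Data.List.Relation.Binary.Permutation.Setoid as Permutation
import Data.List.Relation.Binary.Permutation.Setoid.Properties as Permutationₚ
open import Function.Base using (_∘_)
open import Function.Bundles using (_⇔_; mk⇔; Equivalence)
open import Function.Properties.Equivalence using () renaming (trans to ⇔-trans; sym to ⇔-sym)
open import Relation.Binary.PropositionalEquality
open import Relation.Binary.Definitions using (tri<; tri≈; tri>)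
open import Relation.Nullary using (Dec; yes; no; contradiction; ¬?)
open import Relation.Nullary.Decidable
  using (does; from-yes; True; False; toWitness; toWitnessFalse; _×-dec_; _⊎-dec_; _→-dec_)

instance
  ℕ-number : Number ℕ
  ℕ-number = ℕLiterals.number
  fin-number : ∀ {n} → Number (Fin n)
  fin-number {n} = FinLiterals.number n
  ℚ-number : Number ℚ
  ℚ-number = ℚLiterals.number
  ℚ-negative : Negative ℚ
  ℚ-negative = ℚLiterals.negative

open Equivalence using (to; from)

-- With overloaded numerals the arity of solve is known only after its proof argument has been
-- elaborated, hence the explicit implicit lambdas in solve n e (λ {_ … _} → refl).
open +-*-Solver

does-true⇔ : ∀ {A : Set} (a? : Dec A) → (does a? ≡ true) ⇔ A
does-true⇔ (yes a) = mk⇔ (λ _ → a) (λ _ → refl)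
does-true⇔ (no ¬a) = mk⇔ (λ ()) (λ a → contradiction a ¬a)

+-cancelʳ-≤ : ∀ r {p q} → p + r ℚ.≤ q + r → p ℚ.≤ q
+-cancelʳ-≤ r {p} {q} p+r≤q+r =
  subst₂ ℚ._≤_ (x+r-r≡x p r) (x+r-r≡x q r) (ℚₚ.+-monoˡ-≤ (- r) p+r≤q+r)
  where
  x+r-r≡x : ∀ x r → x + r - r ≡ x
  x+r-r≡x = solve 2 (λ x r → x :+ r :- r := x) (λ {_ _} → refl)

+-cancelˡ-< : ∀ r {p q} → r + p ℚ.< r + q → p ℚ.< q
+-cancelˡ-< r {p} {q} r+p<r+q =
  subst₂ ℚ._<_ (r+x-r≡x r p) (r+x-r≡x r q) (ℚₚ.+-monoˡ-< (- r) r+p<r+q)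
  where
  r+x-r≡x : ∀ r x → r + x - r ≡ x
  r+x-r≡x = solve 2 (λ r x → r :+ x :- r := x) (λ {_ _} → refl)

≤-+-nonneg : ∀ x {y} → 0ℚ ℚ.≤ y → x ℚ.≤ x + y
≤-+-nonneg x {y} 0≤y = subst (ℚ._≤ x + y) (ℚₚ.+-identityʳ x) (ℚₚ.+-monoʳ-≤ x 0≤y)

<-byEval : ∀ {x y} {_ : True (x ℚ.<? y)} → x ℚ.< y
<-byEval {_} {_} {x<y} = toWitness x<y

≮-byEval : ∀ {x y} {_ : False (x ℚ.<? y)} → ¬ x ℚ.< y
≮-byEval {_} {_} {x≮y} = toWitnessFalse x≮y

≰-byEval : ∀ {x y} {_ : False (x ℚ.≤? y)} → ¬ x ℚ.≤ y
≰-byEval {_} {_} {x≰y} = toWitnessFalse x≰y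

-- Lower faces

aff : ∀ {n} → (Fin n → ℚ) → ℚ → Fin n → Fin n → ℚ
aff w c i j = w i + w j + c

lowerFace-transfer : ∀ {n} {ρ ρ' : Dist n} {S} (α : ℚ) .{{_ : ℚ.Positive α}} (u : Fin n → ℚ) (β : ℚ) →
  (∀ i j → i Fin.< j → α * ρ i j + aff u β i j ℚ.≤ ρ' i j) →
  (∀ i j → i Fin.< j → S i j ≡ true → ρ' i j ≡ α * ρ i j + aff u β i j) →
  IsLowerFace ρ S → IsLowerFace ρ' S
lowerFace-transfer {ρ = ρ} {ρ'} {S} α u β below tight (w , c , face) = w' , c' , face'
  where
  instance _ = ℚₚ.pos⇒nonNeg α
  w' : Fin _ → ℚ
  w' i = α * w i + u i
  c' : ℚ
  c' = α * c + β

  aff' : ∀ i j → aff w' c' i j ≡ α * aff w c i j + aff u β i j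
  aff' i j = solve 7 (λ α wi wj c ui uj β →
    (α :* wi :+ ui) :+ (α :* wj :+ uj) :+ (α :* c :+ β) := α :* (wi :+ wj :+ c) :+ (ui :+ uj :+ β))
    (λ {_ _ _ _ _ _ _} → refl) α (w i) (w j) c (u i) (u j) β

  face' : ∀ i j → i Fin.< j → (aff w' c' i j ℚ.≤ ρ' i j) × ((S i j ≡ true) ⇔ (ρ' i j ≡ aff w' c' i j))
  face' i j i<j = lower , mk⇔ onContact offContact
    where
    open ℚₚ.≤-Reasoning
    A = aff w c i j
    U = aff u β i j
    A≤ρ = proj₁ (face i j i<j)
    contact = proj₂ (face i j i<j)

    lower : aff w' c' i j ℚ.≤ ρ' i j
    lower = begin
      aff w' c' i j ≡⟨ aff' i j ⟩
      α * A + U     ≤⟨ ℚₚ.+-monoˡ-≤ U (ℚₚ.*-monoˡ-≤-nonNeg α A≤ρ) ⟩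
      α * ρ i j + U ≤⟨ below i j i<j ⟩
      ρ' i j        ∎

    onContact : S i j ≡ true → ρ' i j ≡ aff w' c' i j
    onContact s = trans (tight i j i<j s) (trans (cong (λ x → α * x + U) (to contact s)) (sym (aff' i j)))

    offContact : ρ' i j ≡ aff w' c' i j → S i j ≡ true
    offContact eq = from contact (ℚₚ.≤-antisym ρ≤A A≤ρ)
      where
      ρ≤A : ρ i j ℚ.≤ A
      ρ≤A = ℚₚ.*-cancelˡ-≤-pos α (+-cancelʳ-≤ U (begin
        α * ρ i j + U ≤⟨ below i j i<j ⟩
        ρ' i j        ≡⟨ trans eq (aff' i j) ⟩
        α * A + U     ∎))

lowerFace-scale : ∀ {n} {ρ ρ' : Dist n} {S} (α : ℚ) .{{_ : ℚ.Positive α}} (β : ℚ) →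
  (∀ i j → i Fin.< j → ρ' i j ≡ α * ρ i j + β) → IsLowerFace ρ S → IsLowerFace ρ' S
lowerFace-scale {ρ = ρ} {ρ'} α β ρ'≡ = lowerFace-transfer α (λ _ → 0ℚ) β
  (λ i j i<j → ℚₚ.≤-reflexive (sym (ρ'≡αρ+β i j i<j)))
  (λ i j i<j _ → ρ'≡αρ+β i j i<j)
  where
  ρ'≡αρ+β : ∀ i j → i Fin.< j → ρ' i j ≡ α * ρ i j + aff (λ _ → 0ℚ) β i j
  ρ'≡αρ+β i j i<j = trans (ρ'≡ i j i<j) (cong (α * ρ i j +_) (sym (ℚₚ.+-identityˡ β)))

IsBit : ℚ → Set
IsBit x = x ≡ 0ℚ ⊎ x ≡ 1ℚ

isBit? : ∀ x → Dec (IsBit x)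
isBit? x = x ℚ.≟ 0ℚ ⊎-dec x ℚ.≟ 1ℚ

bit-complement : ∀ {x} → IsBit x → IsBit (1ℚ - x)
bit-complement (inj₁ refl) = inj₂ refl
bit-complement (inj₂ refl) = inj₁ refl

bit-* : ∀ {x y} → IsBit x → IsBit y → IsBit (x * y)
bit-* {y = y} (inj₁ refl) _ = inj₁ (ℚₚ.*-zeroˡ y)
bit-* {y = y} (inj₂ refl) b = subst IsBit (sym (ℚₚ.*-identityˡ y)) b

scaled-bit-nonneg : ∀ δ .{{_ : ℚ.NonNegative δ}} {x} → IsBit x → 0ℚ ℚ.≤ δ * x
scaled-bit-nonneg δ (inj₁ refl) = ℚₚ.≤-reflexive (sym (ℚₚ.*-zeroʳ δ))
scaled-bit-nonneg δ (inj₂ refl) = subst (0ℚ ℚ.≤_) (sym (ℚₚ.*-identityʳ δ)) (ℚₚ.nonNegative⁻¹ δ)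

NoPairInside EveryPairMeets : ∀ {n} → (Fin n → ℚ) → (Fin n → Fin n → Bool) → Set
NoPairInside   χ S = ∀ i j → i Fin.< j → S i j ≡ true → χ i * χ j ≡ 0ℚ
EveryPairMeets χ S = ∀ i j → i Fin.< j → S i j ≡ true → χ i ≡ 1ℚ ⊎ χ j ≡ 1ℚ

-- If S has no pair inside χ, the old supporting function still works.  Otherwise every pair of S
-- meets χ, and δ (χ i χ j) = δ (χ i + χ j − 1) + δ (1 − χ i)(1 − χ j), where the first term is
-- affine and the second is nonnegative and vanishes on S.
lowerFace-raise : ∀ {n} {ρ ρ' : Dist n} {S} (δ : ℚ) .{{_ : ℚ.NonNegative δ}} (χ : Fin n → ℚ) →
  (∀ i → IsBit (χ i)) →
  (∀ i j → i Fin.< j → ρ' i j ≡ ρ i j + δ * (χ i * χ j)) →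
  NoPairInside χ S ⊎ EveryPairMeets χ S → IsLowerFace ρ S → IsLowerFace ρ' S
lowerFace-raise {ρ = ρ} {ρ'} {S} δ χ bit ρ'≡ (inj₁ noPairInside) =
  lowerFace-transfer 1ℚ (λ _ → 0ℚ) 0ℚ lower tight
  where
  x≡1x+0 : ∀ x → x ≡ 1ℚ * x + (0ℚ + 0ℚ + 0ℚ)
  x≡1x+0 = solve 1 (λ x → x := con 1ℚ :* x :+ (con 0ℚ :+ con 0ℚ :+ con 0ℚ)) (λ {_} → refl)

  lower : ∀ i j → i Fin.< j → 1ℚ * ρ i j + (0ℚ + 0ℚ + 0ℚ) ℚ.≤ ρ' i j
  lower i j i<j = subst₂ ℚ._≤_ (x≡1x+0 (ρ i j)) (sym (ρ'≡ i j i<j))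
    (≤-+-nonneg (ρ i j) (scaled-bit-nonneg δ (bit-* (bit i) (bit j))))

  tight : ∀ i j → i Fin.< j → S i j ≡ true → ρ' i j ≡ 1ℚ * ρ i j + (0ℚ + 0ℚ + 0ℚ)
  tight i j i<j s = begin
    ρ' i j                  ≡⟨ ρ'≡ i j i<j ⟩
    ρ i j + δ * (χ i * χ j) ≡⟨ cong (λ x → ρ i j + δ * x) (noPairInside i j i<j s) ⟩
    ρ i j + δ * 0ℚ          ≡⟨ cong (ρ i j +_) (ℚₚ.*-zeroʳ δ) ⟩
    ρ i j + 0ℚ              ≡⟨ ℚₚ.+-identityʳ (ρ i j) ⟩
    ρ i j                   ≡⟨ x≡1x+0 (ρ i j) ⟩
    1ℚ * ρ i j + (0ℚ + 0ℚ + 0ℚ) ∎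
    where open ≡-Reasoning
lowerFace-raise {ρ = ρ} {ρ'} {S} δ χ bit ρ'≡ (inj₂ everyPairMeets) =
  lowerFace-transfer 1ℚ (λ i → δ * χ i) (- δ) lower tight
  where
  U gap : Fin _ → Fin _ → ℚ
  U = aff (λ i → δ * χ i) (- δ)
  gap i j = δ * ((1ℚ - χ i) * (1ℚ - χ j))

  ρ'≡ρ+U+gap : ∀ i j → i Fin.< j → ρ' i j ≡ (1ℚ * ρ i j + U i j) + gap i j
  ρ'≡ρ+U+gap i j i<j = trans (ρ'≡ i j i<j) (solve 4 (λ r d x y →
    r :+ d :* (x :* y) := (con 1ℚ :* r :+ (d :* x :+ d :* y :+ :- d)) :+ d :* ((con 1ℚ :- x) :* (con 1ℚ :- y)))
    (λ {_ _ _ _} → refl) (ρ i j) δ (χ i) (χ j))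

  gap-vanishes : ∀ {i j} → χ i ≡ 1ℚ ⊎ χ j ≡ 1ℚ → gap i j ≡ 0ℚ
  gap-vanishes {j = j} (inj₁ χi≡1) rewrite χi≡1 = trans (cong (δ *_) (ℚₚ.*-zeroˡ (1ℚ - χ j))) (ℚₚ.*-zeroʳ δ)
  gap-vanishes {i = i} (inj₂ χj≡1) rewrite χj≡1 = trans (cong (δ *_) (ℚₚ.*-zeroʳ (1ℚ - χ i))) (ℚₚ.*-zeroʳ δ)

  lower : ∀ i j → i Fin.< j → 1ℚ * ρ i j + U i j ℚ.≤ ρ' i j
  lower i j i<j = subst (1ℚ * ρ i j + U i j ℚ.≤_) (sym (ρ'≡ρ+U+gap i j i<j))
    (≤-+-nonneg _ (scaled-bit-nonneg δ (bit-* (bit-complement (bit i)) (bit-complement (bit j)))))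

  tight : ∀ i j → i Fin.< j → S i j ≡ true → ρ' i j ≡ 1ℚ * ρ i j + U i j
  tight i j i<j s = trans (ρ'≡ρ+U+gap i j i<j)
    (trans (cong (1ℚ * ρ i j + U i j +_) (gap-vanishes (everyPairMeets i j i<j s))) (ℚₚ.+-identityʳ _))

contactSet : ∀ {n} → Dist n → (Fin n → ℚ) → ℚ → Fin n → Fin n → Bool
contactSet ρ w c i j = does (ρ i j ℚ.≟ aff w c i j)

lowerFace-contactSet : ∀ {n} {ρ : Dist n} w c → (∀ i j → i Fin.< j → aff w c i j ℚ.≤ ρ i j) →
  IsLowerFace ρ (contactSet ρ w c)
lowerFace-contactSet {ρ = ρ} w c below =
  w , c , λ i j i<j → below i j i<j , does-true⇔ (ρ i j ℚ.≟ aff w c i j)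

lowerFace-exchange : ∀ {n} {ρ : Dist n} {S} {a b c d : Fin n} → (∀ i j → ρ i j ≡ ρ j i) → IsLowerFace ρ S →
  a Fin.< b → c Fin.< d → S a b ≡ true → S c d ≡ true → a ≢ d → b ≢ c →
  ρ a b + ρ c d ℚ.≤ ρ a d + ρ b c
lowerFace-exchange {ρ = ρ} {a = a} {b} {c} {d} ρ-sym (w , e , face) a<b c<d sab scd a≢d b≢c = begin
  ρ a b + ρ c d             ≡⟨ cong₂ _+_ (to (proj₂ (face a b a<b)) sab) (to (proj₂ (face c d c<d)) scd) ⟩
  aff w e a b + aff w e c d ≡⟨ repair (w a) (w b) (w c) (w d) e ⟩
  aff w e a d + aff w e b c ≤⟨ ℚₚ.+-mono-≤ (below a≢d) (below b≢c) ⟩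
  ρ a d + ρ b c             ∎
  where
  open ℚₚ.≤-Reasoning
  repair : ∀ wa wb wc wd e → (wa + wb + e) + (wc + wd + e) ≡ (wa + wd + e) + (wb + wc + e)
  repair = solve 5 (λ wa wb wc wd e → (wa :+ wb :+ e) :+ (wc :+ wd :+ e) := (wa :+ wd :+ e) :+ (wb :+ wc :+ e))
    (λ {_ _ _ _ _} → refl)

  below : ∀ {i j} → i ≢ j → aff w e i j ℚ.≤ ρ i j
  below {i} {j} i≢j with <-cmp i j
  ... | tri< i<j _ _ = proj₁ (face i j i<j)
  ... | tri≈ _ i≡j _ = contradiction i≡j i≢j
  ... | tri> _ _ j<i = subst₂ ℚ._≤_ (cong (_+ e) (ℚₚ.+-comm (w j) (w i))) (ρ-sym j i) (proj₁ (face j i j<i))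

-- Nearly uniform metrics

bounded⇒isMetric : ∀ {n} {ρ : Dist n} (a : ℚ) → 0ℚ ℚ.< a →
  (∀ i j → ρ i j ≡ ρ j i) → (∀ i → ρ i i ≡ 0ℚ) →
  (∀ i j → i ≢ j → a ℚ.≤ ρ i j × ρ i j ℚ.≤ a + a) → IsMetric n ρ
bounded⇒isMetric {n} {ρ} a 0<a ρ-sym ρ-diag bounds = record
  { symm = ρ-sym
  ; diag = ρ-diag
  ; pos  = λ i j i≢j → ℚₚ.<-≤-trans 0<a (proj₁ (bounds i j i≢j))
  ; tri  = tri
  }
  where
  nonneg : ∀ i j → 0ℚ ℚ.≤ ρ i j
  nonneg i j with i Fin.≟ j
  ... | yes refl = ℚₚ.≤-reflexive (sym (ρ-diag i))
  ... | no i≢j   = ℚₚ.≤-trans (ℚₚ.<⇒≤ 0<a) (proj₁ (bounds i j i≢j))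

  tri : ∀ i j k → ρ i k ℚ.≤ ρ i j + ρ j k
  tri i j k with i Fin.≟ j | j Fin.≟ k | i Fin.≟ k
  ... | yes refl | _        | _        =
    ℚₚ.≤-reflexive (sym (trans (cong (_+ ρ i k) (ρ-diag i)) (ℚₚ.+-identityˡ _)))
  ... | no _     | yes refl | _        =
    ℚₚ.≤-reflexive (sym (trans (cong (ρ i j +_) (ρ-diag j)) (ℚₚ.+-identityʳ _)))
  ... | no _     | no _     | yes refl =
    subst (ℚ._≤ ρ i j + ρ j i) (sym (ρ-diag i)) (ℚₚ.+-mono-≤ (nonneg i j) (nonneg j i))
  ... | no i≢j   | no j≢k   | no i≢k   =
    ℚₚ.≤-trans (proj₂ (bounds i k i≢k)) (ℚₚ.+-mono-≤ (proj₁ (bounds i j i≢j)) (proj₁ (bounds j k j≢k)))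

-- Vertices 0, 1, 2 are the corners of the triangle and every other vertex has kind 3.  The metrics
-- below see a pair of distinct vertices only through their kinds, so facts about them come down to
-- finite checks over Fin 4, which are decided by evaluation (from-yes).
kind : ∀ {k} → Fin (3 ℕ.+ k) → Fin 4
kind zero                = 0
kind (suc zero)          = 1
kind (suc (suc zero))    = 2
kind (suc (suc (suc _))) = 3

kind-injective : ∀ {k} {i j : Fin (3 ℕ.+ k)} → kind i ≡ kind j → kind i ≢ 3 → i ≡ j
kind-injective {i = zero}              {zero}              _ _   = refl
kind-injective {i = suc zero}          {suc zero}          _ _   = refl
kind-injective {i = suc (suc zero)}    {suc (suc zero)}    _ _   = refl
kind-injective {i = suc (suc (suc _))} {_}                 _ i≢3 = contradiction refl i≢3
kind-injective {i = zero}              {suc zero}          ()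
kind-injective {i = zero}              {suc (suc zero)}    ()
kind-injective {i = zero}              {suc (suc (suc _))} ()
kind-injective {i = suc zero}          {zero}              ()
kind-injective {i = suc zero}          {suc (suc zero)}    ()
kind-injective {i = suc zero}          {suc (suc (suc _))} ()
kind-injective {i = suc (suc zero)}    {zero}              ()
kind-injective {i = suc (suc zero)}    {suc zero}          ()
kind-injective {i = suc (suc zero)}    {suc (suc (suc _))} ()

Separated : Fin 4 → Fin 4 → Set
Separated p q = p ≡ q → p ≡ 3

separated? : ∀ p q → Dec (Separated p q)
separated? p q = p Fin.≟ q →-dec p Fin.≟ 3

kind-separated : ∀ {k} {i j : Fin (3 ℕ.+ k)} → i ≢ j → Separated (kind i) (kind j)
kind-separated {i = i} i≢j ki≡kj with kind i Fin.≟ 3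
... | yes ki≡3 = ki≡3
... | no ki≢3  = contradiction (kind-injective ki≡kj ki≢3) i≢j

Weights : Set
Weights = Fin 4 → Fin 4 → ℚ

triangle : ℚ → ℚ → ℚ → Weights
triangle a b c zero             (suc zero)       = a
triangle a b c (suc zero)       zero             = a
triangle a b c zero             (suc (suc zero)) = b
triangle a b c (suc (suc zero)) zero             = b
triangle a b c (suc zero)       (suc (suc zero)) = c
triangle a b c (suc (suc zero)) (suc zero)       = c
triangle a b c _                _                = 0ℚ

nearUniform : ∀ {k} → Weights → Dist (3 ℕ.+ k)
nearUniform T i j = if does (i Fin.≟ j) then 0ℚ else 10 + T (kind i) (kind j)

nearUniform-diag : ∀ {k} T (i : Fin (3 ℕ.+ k)) → nearUniform T i i ≡ 0ℚ
nearUniform-diag T i with i Fin.≟ i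
... | yes _  = refl
... | no i≢i = contradiction refl i≢i

nearUniform-off : ∀ {k} T {i j : Fin (3 ℕ.+ k)} → i ≢ j → nearUniform T i j ≡ 10 + T (kind i) (kind j)
nearUniform-off T {i} {j} i≢j with i Fin.≟ j
... | yes i≡j = contradiction i≡j i≢j
... | no _    = refl

Admissible : Weights → Set
Admissible T = ∀ p q → T p q ≡ T q p × -4 ℚ.≤ T p q × T p q ℚ.≤ 2

admissible? : ∀ T → Dec (Admissible T)
admissible? T = all? λ p → all? λ q → T p q ℚ.≟ T q p ×-dec -4 ℚ.≤? T p q ×-dec T p q ℚ.≤? 2

nearUniform-isMetric : ∀ {k} T → Admissible T → IsMetric (3 ℕ.+ k) (nearUniform T)
nearUniform-isMetric T adm = bounded⇒isMetric 6 (<-byEval {0ℚ}) symmetric (nearUniform-diag T) bounds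
  where
  symmetric : ∀ i j → nearUniform T i j ≡ nearUniform T j i
  symmetric i j with i Fin.≟ j | j Fin.≟ i
  ... | yes _   | yes _   = refl
  ... | no _    | no _    = cong (10 +_) (proj₁ (adm (kind i) (kind j)))
  ... | yes i≡j | no j≢i  = contradiction (sym i≡j) j≢i
  ... | no i≢j  | yes j≡i = contradiction (sym j≡i) i≢j

  bounds : ∀ i j → i ≢ j → 6 ℚ.≤ nearUniform T i j × nearUniform T i j ℚ.≤ 6 + 6
  bounds i j i≢j rewrite nearUniform-off T i≢j =
    ℚₚ.+-monoʳ-≤ 10 (proj₁ (proj₂ (adm (kind i) (kind j)))) , ℚₚ.+-monoʳ-≤ 10 (proj₂ (proj₂ (adm (kind i) (kind j))))

Transforms : (Fin 4 → Fin 4 → ℚ → ℚ) → Weights → Weights → Set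
Transforms F T T' = ∀ p q → Separated p q → 10 + T' p q ≡ F p q (10 + T p q)

transforms? : ∀ F T T' → Dec (Transforms F T T')
transforms? F T T' = all? λ p → all? λ q → separated? p q →-dec 10 + T' p q ℚ.≟ F p q (10 + T p q)

nearUniform-transform : ∀ {k} F T T' → Transforms F T T' →
  ∀ {i j : Fin (3 ℕ.+ k)} → i ≢ j → nearUniform T' i j ≡ F (kind i) (kind j) (nearUniform T i j)
nearUniform-transform F T T' transforms {i} {j} i≢j
  rewrite nearUniform-off T i≢j | nearUniform-off T' i≢j = transforms (kind i) (kind j) (kind-separated i≢j)

-- Matchings and the Wasserstein fan

TriangleEdge : Fin 4 → Fin 4 → Set
TriangleEdge p q = p ≢ q × p ≢ 3 × q ≢ 3

triangleEdge? : ∀ p q → Dec (TriangleEdge p q)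
triangleEdge? p q = ¬? (p Fin.≟ q) ×-dec ¬? (p Fin.≟ 3) ×-dec ¬? (q Fin.≟ 3)

triangleEdges-meet : ∀ p q r s → TriangleEdge p q → TriangleEdge r s → r ≡ p ⊎ r ≡ q ⊎ s ≡ p ⊎ s ≡ q
triangleEdges-meet = from-yes (all? λ p → all? λ q → all? λ r → all? λ s →
  triangleEdge? p q →-dec triangleEdge? r s →-dec (r Fin.≟ p ⊎-dec r Fin.≟ q ⊎-dec s Fin.≟ p ⊎-dec s Fin.≟ q))

vertexTriangleEdges-meet : ∀ {k} {a b c d : Fin (3 ℕ.+ k)} →
  TriangleEdge (kind a) (kind b) → TriangleEdge (kind c) (kind d) → c ≡ a ⊎ c ≡ b ⊎ d ≡ a ⊎ d ≡ b
vertexTriangleEdges-meet eab@(_ , a∘ , b∘) ecd with triangleEdges-meet _ _ _ _ eab ecd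
... | inj₁ c~a               = inj₁ (sym (kind-injective (sym c~a) a∘))
... | inj₂ (inj₁ c~b)        = inj₂ (inj₁ (sym (kind-injective (sym c~b) b∘)))
... | inj₂ (inj₂ (inj₁ d~a)) = inj₂ (inj₂ (inj₁ (sym (kind-injective (sym d~a) a∘))))
... | inj₂ (inj₂ (inj₂ d~b)) = inj₂ (inj₂ (inj₂ (sym (kind-injective (sym d~b) b∘))))

VanishesOffTriangle : Weights → Set
VanishesOffTriangle T = ∀ p q → ¬ TriangleEdge p q → T p q ≡ 0ℚ

vanishesOffTriangle? : ∀ T → Dec (VanishesOffTriangle T)
vanishesOffTriangle? T = all? λ p → all? λ q → ¬? (triangleEdge? p q) →-dec T p q ℚ.≟ 0ℚ

endpoints : ∀ {A : Set} {r} → Vec A r → Vec A r → List A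
endpoints []       []       = List.[]
endpoints (a ∷ as) (b ∷ bs) = a List.∷ b List.∷ endpoints as bs

module _ {A : Set} where
  open Permutation (setoid A)
  open Permutationₚ (setoid A)

  endpoints-↭ : ∀ {r} (as bs : Vec A r) → toList as ++ toList bs ↭ endpoints as bs
  endpoints-↭ []       []       = ↭-refl
  endpoints-↭ (a ∷ as) (b ∷ bs) =
    ↭-prep a (↭-trans (↭-shift (toList as) (toList bs)) (↭-prep b (endpoints-↭ as bs)))

  rotate-↭ : ∀ {r} (bs : Vec A (suc r)) → toList bs ↭ toList (rotate bs)
  rotate-↭ (b ∷ bs) rewrite toList-∷ʳ b bs = ++-comm List.[ b ] (toList bs)

  unique-endpoints : ∀ {r} (as bs : Vec A r) → Unique (toList as ++ toList bs) → Unique (endpoints as bs)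
  unique-endpoints as bs = Unique-resp-↭ (endpoints-↭ as bs)

  unique-rotate : ∀ {r} (as bs : Vec A (suc r)) →
    Unique (toList as ++ toList bs) → Unique (toList as ++ toList (rotate bs))
  unique-rotate as bs = Unique-resp-↭ (++⁺ˡ (toList as) (rotate-↭ bs))

-- The kinds of the first triangle edge of the matching; (3 , 3) if there is none.
selectedEdge : ∀ {k r} → Vec (Fin (3 ℕ.+ k)) r → Vec (Fin (3 ℕ.+ k)) r → Fin 4 × Fin 4
selectedEdge []       []       = 3 , 3
selectedEdge (a ∷ as) (b ∷ bs) with triangleEdge? (kind a) (kind b)
... | yes _ = kind a , kind b
... | no _  = selectedEdge as bs

selectedEdge-notTriangleEdge : ∀ {k r} {a b : Fin (3 ℕ.+ k)} (cs ds : Vec (Fin (3 ℕ.+ k)) r) →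
  TriangleEdge (kind a) (kind b) → All (a ≢_) (endpoints cs ds) → All (b ≢_) (endpoints cs ds) →
  ¬ uncurry TriangleEdge (selectedEdge cs ds)
selectedEdge-notTriangleEdge [] [] _ _ _ (_ , 3≢3 , _) = 3≢3 refl
selectedEdge-notTriangleEdge (c ∷ cs) (d ∷ ds) eab (a≢c ∷ a≢d ∷ a∉) (b≢c ∷ b≢d ∷ b∉)
  with triangleEdge? (kind c) (kind d)
... | yes ecd = λ _ → disjoint (vertexTriangleEdges-meet eab ecd)
  where
  disjoint : ¬ (c ≡ _ ⊎ c ≡ _ ⊎ d ≡ _ ⊎ d ≡ _)
  disjoint (inj₁ c≡a)               = a≢c (sym c≡a)
  disjoint (inj₂ (inj₁ c≡b))        = b≢c (sym c≡b)
  disjoint (inj₂ (inj₂ (inj₁ d≡a))) = a≢d (sym d≡a)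
  disjoint (inj₂ (inj₂ (inj₂ d≡b))) = b≢d (sym d≡b)
... | no _ = selectedEdge-notTriangleEdge cs ds eab a∉ b∉

matchingSum-nearUniform : ∀ {k r} (T : Weights) → VanishesOffTriangle T → (as bs : Vec (Fin (3 ℕ.+ k)) r) →
  Unique (endpoints as bs) →
  sumℚ (zipWith (nearUniform T) as bs) ≡ sumℚ (replicate r 10) + uncurry T (selectedEdge as bs)
matchingSum-nearUniform T vanishes [] [] _ = cong (0ℚ +_) (sym (vanishes 3 3 λ (_ , 3≢3 , _) → 3≢3 refl))
matchingSum-nearUniform {r = suc r} T vanishes (a ∷ as) (b ∷ bs) ((a≢b ∷ a∉) ∷ b∉ ∷ unique)
  with triangleEdge? (kind a) (kind b)
... | yes eab = begin
  nearUniform T a b + sumℚ (zipWith (nearUniform T) as bs)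
    ≡⟨ cong₂ _+_ (nearUniform-off T a≢b) (matchingSum-nearUniform T vanishes as bs unique) ⟩
  (10 + T (kind a) (kind b)) + (R + uncurry T (selectedEdge as bs))
    ≡⟨ cong (λ x → (10 + T (kind a) (kind b)) + (R + x))
            (vanishes _ _ (selectedEdge-notTriangleEdge as bs eab a∉ b∉)) ⟩
  (10 + T (kind a) (kind b)) + (R + 0ℚ)
    ≡⟨ solve 2 (λ t r → (con 10 :+ t) :+ (r :+ con 0ℚ) := (con 10 :+ r) :+ t) (λ {_ _} → refl) _ R ⟩
  (10 + R) + T (kind a) (kind b) ∎
  where
  open ≡-Reasoning
  R = sumℚ (replicate r 10)
... | no ¬eab = begin
  nearUniform T a b + sumℚ (zipWith (nearUniform T) as bs)
    ≡⟨ cong₂ _+_ (nearUniform-off T a≢b) (matchingSum-nearUniform T vanishes as bs unique) ⟩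
  (10 + T (kind a) (kind b)) + (R + uncurry T (selectedEdge as bs))
    ≡⟨ cong (λ x → (10 + x) + (R + uncurry T (selectedEdge as bs))) (vanishes _ _ ¬eab) ⟩
  (10 + 0ℚ) + (R + uncurry T (selectedEdge as bs))
    ≡⟨ solve 2 (λ r s → (con 10 :+ con 0ℚ) :+ (r :+ s) := (con 10 :+ r) :+ s) (λ {_ _} → refl) R _ ⟩
  (10 + R) + uncurry T (selectedEdge as bs) ∎
  where
  open ≡-Reasoning
  R = sumℚ (replicate r 10)

shifted-<-⇔ : ∀ {x y} R {s t} → x ≡ R + s → y ≡ R + t → (x ℚ.< y) ⇔ (s ℚ.< t)
shifted-<-⇔ R refl refl = mk⇔ (+-cancelˡ-< R) (ℚₚ.+-monoʳ-< R)

<-⇔⇒≡-⇔ : ∀ {x y x' y'} → (x ℚ.< y ⇔ x' ℚ.< y') → (y ℚ.< x ⇔ y' ℚ.< x') → (x ≡ y ⇔ x' ≡ y')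
<-⇔⇒≡-⇔ lt gt = mk⇔ (≡-transfer lt gt) (≡-transfer (⇔-sym lt) (⇔-sym gt))
  where
  ≡-transfer : ∀ {x y x' y'} → (x ℚ.< y ⇔ x' ℚ.< y') → (y ℚ.< x ⇔ y' ℚ.< x') → x ≡ y → x' ≡ y'
  ≡-transfer {x' = x'} {y'} lt gt refl with ℚₚ.<-cmp x' y'
  ... | tri< x'<y' _ _ = contradiction (from lt x'<y') (ℚₚ.<-irrefl refl)
  ... | tri≈ _ x'≡y' _ = x'≡y'
  ... | tri> _ _ y'<x' = contradiction (from gt y'<x') (ℚₚ.<-irrefl refl)

SameOrder : Weights → Weights → Set
SameOrder T T' = ∀ p q p' q' →
  (T p q ℚ.< T p' q' → T' p q ℚ.< T' p' q') × (T' p q ℚ.< T' p' q' → T p q ℚ.< T p' q')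

sameOrder? : ∀ T T' → Dec (SameOrder T T')
sameOrder? T T' = all? λ p → all? λ q → all? λ p' → all? λ q' →
  (T p q ℚ.<? T p' q' →-dec T' p q ℚ.<? T' p' q') ×-dec (T' p q ℚ.<? T' p' q' →-dec T p q ℚ.<? T p' q')

sameCell-nearUniform : ∀ {k} {T T'} → VanishesOffTriangle T → VanishesOffTriangle T' → SameOrder T T' →
  SameCell {3 ℕ.+ k} (nearUniform T) (nearUniform T')
sameCell-nearUniform {T = T} {T'} vT vT' order h@(hyp m as bs distinct) =
  lhs<rhs , <-⇔⇒≡-⇔ lhs<rhs rhs<lhs , rhs<lhs
  where
  s t : Fin 4 × Fin 4
  s = selectedEdge as bs
  t = selectedEdge as (rotate bs)
  R = sumℚ (replicate (suc (suc m)) 10)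

  lhs : ∀ W → VanishesOffTriangle W → lhsH (nearUniform W) h ≡ R + uncurry W s
  lhs W vW = matchingSum-nearUniform W vW as bs (unique-endpoints as bs distinct)

  rhs : ∀ W → VanishesOffTriangle W → rhsH (nearUniform W) h ≡ R + uncurry W t
  rhs W vW = matchingSum-nearUniform W vW as (rotate bs)
    (unique-endpoints as (rotate bs) (unique-rotate as bs distinct))

  order-⇔ : ∀ e f → (uncurry T e ℚ.< uncurry T f) ⇔ (uncurry T' e ℚ.< uncurry T' f)
  order-⇔ (p , q) (p' , q') = mk⇔ (proj₁ (order p q p' q')) (proj₂ (order p q p' q'))

  lhs<rhs : (lhsH (nearUniform T) h ℚ.< rhsH (nearUniform T) h) ⇔ (lhsH (nearUniform T') h ℚ.< rhsH (nearUniform T') h)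
  lhs<rhs = ⇔-trans (shifted-<-⇔ R (lhs T vT) (rhs T vT))
              (⇔-trans (order-⇔ s t) (⇔-sym (shifted-<-⇔ R (lhs T' vT') (rhs T' vT'))))

  rhs<lhs : (rhsH (nearUniform T) h ℚ.< lhsH (nearUniform T) h) ⇔ (rhsH (nearUniform T') h ℚ.< lhsH (nearUniform T') h)
  rhs<lhs = ⇔-trans (shifted-<-⇔ R (rhs T vT) (lhs T vT))
              (⇔-trans (order-⇔ t s) (⇔-sym (shifted-<-⇔ R (rhs T' vT') (lhs T' vT'))))

-- (a) One cell of the Wasserstein fan, two subdivisions

TA TB : Weights
TA = triangle -4 -3 -3
TB = triangle -4 -1 -1

ρA ρB : ∀ {k} → Dist (3 ℕ.+ k)
ρA = nearUniform TA
ρB = nearUniform TB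

ρA-isMetric : ∀ {k} → IsMetric (3 ℕ.+ k) ρA
ρA-isMetric = nearUniform-isMetric TA (from-yes (admissible? TA))

ρB-isMetric : ∀ {k} → IsMetric (3 ℕ.+ k) ρB
ρB-isMetric = nearUniform-isMetric TB (from-yes (admissible? TB))

sameCell-ρA-ρB : ∀ {k} → SameCell {3 ℕ.+ k} ρA ρB
sameCell-ρA-ρB = sameCell-nearUniform (from-yes (vanishesOffTriangle? TA)) (from-yes (vanishesOffTriangle? TB))
                                      (from-yes (sameOrder? TA TB))

-- The face of Δ₂,ₙ(ρA) cut out by wA contains 02, 12 and 34.  It is no face of Δ₂,ₙ(ρB), since
-- e₀₂ + e₁₂ + e₃₄ = e₀₁ + e₂₃ + e₂₄ while ρB 0 2 + ρB 1 2 + ρB 3 4 > ρB 0 1 + ρB 2 3 + ρB 2 4.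
WA : Fin 4 → ℚ
WA = lookup (-3 ∷ -3 ∷ 0ℚ ∷ 0ℚ ∷ [])

wA : ∀ {k} → Fin (3 ℕ.+ k) → ℚ
wA i = WA (kind i)

lowerFace-ρA : ∀ {k} → IsLowerFace (ρA {k}) (contactSet ρA wA 10)
lowerFace-ρA = lowerFace-contactSet wA 10 λ i j i<j →
  subst (aff wA 10 i j ℚ.≤_) (sym (nearUniform-off TA (<⇒≢ i<j))) (below (kind i) (kind j) (kind-separated (<⇒≢ i<j)))
  where
  below : ∀ p q → Separated p q → WA p + WA q + 10 ℚ.≤ 10 + TA p q
  below = from-yes (all? λ p → all? λ q → separated? p q →-dec WA p + WA q + 10 ℚ.≤? 10 + TA p q)

¬lowerFace-ρB : ∀ {m} → ¬ IsLowerFace (ρB {suc (suc m)}) (contactSet ρA wA 10)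
¬lowerFace-ρB {m} (w , c , face) = ≰-byEval (begin
  B 0 2 + B 1 2 + B 3 4
    ≡⟨ cong₂ _+_ (cong₂ _+_ (contact 0 2 z<s refl) (contact 1 2 (s<s z<s) refl)) (contact 3 4 (s<s (s<s (s<s z<s))) refl) ⟩
  A 0 2 + A 1 2 + A 3 4
    ≡⟨ rebalance (w 0) (w 1) (w 2) (w 3) (w 4) c ⟩
  A 0 1 + A 2 3 + A 2 4
    ≤⟨ ℚₚ.+-mono-≤ (ℚₚ.+-mono-≤ (below 0 1 z<s) (below 2 3 (s<s (s<s z<s)))) (below 2 4 (s<s (s<s z<s))) ⟩
  B 0 1 + B 2 3 + B 2 4 ∎)
  where
  open ℚₚ.≤-Reasoning
  B = ρB {suc (suc m)}
  A = aff w c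

  contact : ∀ i j → i Fin.< j → contactSet ρA wA 10 i j ≡ true → B i j ≡ A i j
  contact i j i<j = to (proj₂ (face i j i<j))

  below : ∀ i j → i Fin.< j → A i j ℚ.≤ B i j
  below i j i<j = proj₁ (face i j i<j)

  rebalance : ∀ w₀ w₁ w₂ w₃ w₄ c →
    (w₀ + w₂ + c) + (w₁ + w₂ + c) + (w₃ + w₄ + c) ≡ (w₀ + w₁ + c) + (w₂ + w₃ + c) + (w₂ + w₄ + c)
  rebalance = solve 6 (λ w₀ w₁ w₂ w₃ w₄ c →
    (w₀ :+ w₂ :+ c) :+ (w₁ :+ w₂ :+ c) :+ (w₃ :+ w₄ :+ c) := (w₀ :+ w₁ :+ c) :+ (w₂ :+ w₃ :+ c) :+ (w₂ :+ w₄ :+ c))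
    (λ {_ _ _ _ _ _} → refl)

¬sameSubdivision-ρA-ρB : ∀ {m} → ¬ SameSubdivision (ρA {suc (suc m)}) ρB
¬sameSubdivision-ρA-ρB same = ¬lowerFace-ρB (to (same (contactSet ρA wA 10)) lowerFace-ρA)

-- (b) One subdivision, two cells of the Wasserstein fan

T₁ T₁⁺ T₂ T₂⁺ : Weights
T₁  = triangle 1 2 0ℚ
T₁⁺ = triangle 4 2 0ℚ
T₂  = triangle 2 1 0ℚ
T₂⁺ = triangle 2 4 0ℚ

-- ρ₁⁺ raises the point 01 of ρ₁ by 3 and ρ₂ = ½ ρ₁⁺ + 5; symmetrically for ρ₂⁺ with the point 02.
ρ₁ ρ₁⁺ ρ₂ ρ₂⁺ : ∀ {k} → Dist (3 ℕ.+ k)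
ρ₁  = nearUniform T₁
ρ₁⁺ = nearUniform T₁⁺
ρ₂  = nearUniform T₂
ρ₂⁺ = nearUniform T₂⁺

X₀₁ X₀₂ : Fin 4 → ℚ
X₀₁ = lookup (1ℚ ∷ 1ℚ ∷ 0ℚ ∷ 0ℚ ∷ [])
X₀₂ = lookup (1ℚ ∷ 0ℚ ∷ 1ℚ ∷ 0ℚ ∷ [])

χ₀₁ χ₀₂ : ∀ {k} → Fin (3 ℕ.+ k) → ℚ
χ₀₁ i = X₀₁ (kind i)
χ₀₂ i = X₀₂ (kind i)

ρ₁-isMetric : ∀ {k} → IsMetric (3 ℕ.+ k) ρ₁
ρ₁-isMetric = nearUniform-isMetric T₁ (from-yes (admissible? T₁))

ρ₂-isMetric : ∀ {k} → IsMetric (3 ℕ.+ k) ρ₂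
ρ₂-isMetric = nearUniform-isMetric T₂ (from-yes (admissible? T₂))

-- A face through 01 contains no pair disjoint from {0, 1}: such a pair would violate the exchange
-- inequality with a partner of kind 3.
lowerFace-ρ₁⇒ρ₁⁺ : ∀ {k S} → IsLowerFace (ρ₁ {k}) S → IsLowerFace ρ₁⁺ S
lowerFace-ρ₁⇒ρ₁⁺ {k} {S} face = lowerFace-raise 3 χ₀₁ isBit raised dichotomy face
  where
  isBit : ∀ i → IsBit (χ₀₁ i)
  isBit i = from-yes (all? (isBit? ∘ X₀₁)) (kind i)

  F : Fin 4 → Fin 4 → ℚ → ℚ
  F p q x = x + 3 * (X₀₁ p * X₀₁ q)

  raised : ∀ i j → i Fin.< j → ρ₁⁺ i j ≡ ρ₁ i j + 3 * (χ₀₁ i * χ₀₁ j)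
  raised i j i<j = nearUniform-transform F T₁ T₁⁺ (from-yes (transforms? F T₁ T₁⁺)) (<⇒≢ i<j)

  dichotomy : NoPairInside χ₀₁ S ⊎ EveryPairMeets χ₀₁ S
  dichotomy with S 0 1 in s₀₁
  ... | false = inj₁ noPairInside
    where
    noPairInside : NoPairInside χ₀₁ S
    noPairInside zero (suc zero) _ s = contradiction (trans (sym s) s₀₁) λ ()
    noPairInside i (suc (suc zero)) _ _ = ℚₚ.*-zeroʳ (χ₀₁ i)
    noPairInside i (suc (suc (suc _))) _ _ = ℚₚ.*-zeroʳ (χ₀₁ i)
    noPairInside zero zero ()
    noPairInside (suc _) zero ()
    noPairInside (suc zero) (suc zero) (s<s ())
    noPairInside (suc (suc _)) (suc zero) (s<s ())
  ... | true = inj₂ everyPairMeets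
    where
    everyPairMeets : EveryPairMeets χ₀₁ S
    everyPairMeets zero _ _ _ = inj₁ refl
    everyPairMeets (suc zero) _ _ _ = inj₁ refl
    everyPairMeets (suc (suc zero)) j@(suc (suc (suc _))) i<j s =
      ⊥-elim (≰-byEval (subst (λ x → ρ₁ {k} 0 1 + x ℚ.≤ ρ₁ 0 j + ρ₁ {k} 1 2) (nearUniform-off T₁ (<⇒≢ i<j))
                          (lowerFace-exchange (IsMetric.symm ρ₁-isMetric) face z<s i<j s₀₁ s (λ ()) (λ ()))))
    everyPairMeets i@(suc (suc (suc _))) j@(suc (suc (suc _))) i<j s =
      ⊥-elim (≰-byEval (subst (λ x → ρ₁ {k} 0 1 + x ℚ.≤ ρ₁ 0 j + ρ₁ 1 i) (nearUniform-off T₁ (<⇒≢ i<j))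
                          (lowerFace-exchange (IsMetric.symm ρ₁-isMetric) face z<s i<j s₀₁ s (λ ()) (λ ()))))
    everyPairMeets (suc (suc _)) zero ()
    everyPairMeets (suc (suc _)) (suc zero) (s<s ())
    everyPairMeets (suc (suc zero)) (suc (suc zero)) (s<s (s<s ()))
    everyPairMeets (suc (suc (suc _))) (suc (suc zero)) (s<s (s<s ()))

lowerFace-ρ₂⇒ρ₂⁺ : ∀ {k S} → IsLowerFace (ρ₂ {k}) S → IsLowerFace ρ₂⁺ S
lowerFace-ρ₂⇒ρ₂⁺ {k} {S} face = lowerFace-raise 3 χ₀₂ isBit raised dichotomy face
  where
  isBit : ∀ i → IsBit (χ₀₂ i)
  isBit i = from-yes (all? (isBit? ∘ X₀₂)) (kind i)

  F : Fin 4 → Fin 4 → ℚ → ℚ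
  F p q x = x + 3 * (X₀₂ p * X₀₂ q)

  raised : ∀ i j → i Fin.< j → ρ₂⁺ i j ≡ ρ₂ i j + 3 * (χ₀₂ i * χ₀₂ j)
  raised i j i<j = nearUniform-transform F T₂ T₂⁺ (from-yes (transforms? F T₂ T₂⁺)) (<⇒≢ i<j)

  dichotomy : NoPairInside χ₀₂ S ⊎ EveryPairMeets χ₀₂ S
  dichotomy with S 0 2 in s₀₂
  ... | false = inj₁ noPairInside
    where
    noPairInside : NoPairInside χ₀₂ S
    noPairInside zero (suc (suc zero)) _ s = contradiction (trans (sym s) s₀₂) λ ()
    noPairInside i (suc zero) _ _ = ℚₚ.*-zeroʳ (χ₀₂ i)
    noPairInside i (suc (suc (suc _))) _ _ = ℚₚ.*-zeroʳ (χ₀₂ i)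
    noPairInside (suc zero) j _ _ = ℚₚ.*-zeroˡ (χ₀₂ j)
    noPairInside zero zero ()
    noPairInside (suc _) zero ()
    noPairInside (suc (suc _)) (suc (suc zero)) (s<s (s<s ()))
  ... | true = inj₂ everyPairMeets
    where
    everyPairMeets : EveryPairMeets χ₀₂ S
    everyPairMeets zero _ _ _ = inj₁ refl
    everyPairMeets (suc (suc zero)) _ _ _ = inj₁ refl
    everyPairMeets (suc zero) (suc (suc zero)) _ _ = inj₂ refl
    everyPairMeets (suc zero) j@(suc (suc (suc _))) i<j s =
      ⊥-elim (≰-byEval (lowerFace-exchange (IsMetric.symm ρ₂-isMetric) face z<s i<j s₀₂ s (λ ()) (λ ())))
    everyPairMeets i@(suc (suc (suc _))) j@(suc (suc (suc _))) i<j s =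
      ⊥-elim (≰-byEval (subst (λ x → ρ₂ {k} 0 2 + x ℚ.≤ ρ₂ 0 j + ρ₂ 2 i) (nearUniform-off T₂ (<⇒≢ i<j))
                          (lowerFace-exchange (IsMetric.symm ρ₂-isMetric) face z<s i<j s₀₂ s (λ ()) (λ ()))))
    everyPairMeets (suc _) zero ()
    everyPairMeets (suc zero) (suc zero) (s<s ())
    everyPairMeets (suc (suc (suc _))) (suc zero) (s<s ())
    everyPairMeets (suc (suc (suc _))) (suc (suc zero)) (s<s (s<s ()))

rescale : Fin 4 → Fin 4 → ℚ → ℚ
rescale _ _ x = ½ * x + 5

lowerFace-ρ₁⁺⇒ρ₂ : ∀ {k S} → IsLowerFace (ρ₁⁺ {k}) S → IsLowerFace ρ₂ S
lowerFace-ρ₁⁺⇒ρ₂ = lowerFace-scale ½ 5 λ i j i<j →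
  nearUniform-transform rescale T₁⁺ T₂ (from-yes (transforms? rescale T₁⁺ T₂)) (<⇒≢ i<j)

lowerFace-ρ₂⁺⇒ρ₁ : ∀ {k S} → IsLowerFace (ρ₂⁺ {k}) S → IsLowerFace ρ₁ S
lowerFace-ρ₂⁺⇒ρ₁ = lowerFace-scale ½ 5 λ i j i<j →
  nearUniform-transform rescale T₂⁺ T₁ (from-yes (transforms? rescale T₂⁺ T₁)) (<⇒≢ i<j)

sameSubdivision-ρ₁-ρ₂ : ∀ {k} → SameSubdivision (ρ₁ {k}) ρ₂
sameSubdivision-ρ₁-ρ₂ S = mk⇔ (lowerFace-ρ₁⁺⇒ρ₂ ∘ lowerFace-ρ₁⇒ρ₁⁺) (lowerFace-ρ₂⁺⇒ρ₁ ∘ lowerFace-ρ₂⇒ρ₂⁺)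

¬sameCell-ρ₁-ρ₂ : ∀ {m} → ¬ SameCell (ρ₁ {suc m}) ρ₂
¬sameCell-ρ₁-ρ₂ sameCell = ≮-byEval (to (proj₁ (sameCell h)) <-byEval)
  where
  h = hyp 0 (0 ∷ 3 ∷ []) (1 ∷ 2 ∷ [])
    (((λ ()) ∷ (λ ()) ∷ (λ ()) ∷ []) ∷ ((λ ()) ∷ (λ ()) ∷ []) ∷ ((λ ()) ∷ []) ∷ [] ∷ [])

theorem5p4 : ∀ (n : ℕ) → 5 ≤ n →
    (Σ (Dist n) λ ρ → Σ (Dist n) λ ρ' →
       IsMetric n ρ × IsMetric n ρ' × SameCell ρ ρ' × ¬ SameSubdivision ρ ρ')
    ×
    (Σ (Dist n) λ ρ → Σ (Dist n) λ ρ' →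
       IsMetric n ρ × IsMetric n ρ' × SameSubdivision ρ ρ' × ¬ SameCell ρ ρ')
theorem5p4 (suc (suc (suc (suc (suc m))))) (s≤s (s≤s (s≤s (s≤s (s≤s z≤n))))) =
    (ρA , ρB , ρA-isMetric , ρB-isMetric , sameCell-ρA-ρB , ¬sameSubdivision-ρA-ρB)
  , (ρ₁ , ρ₂ , ρ₁-isMetric , ρ₂-isMetric , sameSubdivision-ρ₁-ρ₂ , ¬sameCell-ρ₁-ρ₂)
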